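{- Let $F$ be a CNF with variables $X_1,\dots,X_n$ and clauses $C_1,\dots,C_m$, and let $G$ be its incidence graph. Let $(P,\mathbf{B})$ be a path decomposition of $G$ of width $p$, with the vertices of the path $P$ enumerated in path order as $v_1,\dots,v_r$. For each variable $X_i$ let $f(X_i)$ be the smallest $j$ such that $X_i\in B(v_j)$. Let $SV$ be a linear ordering of $X_1,\dots,X_n$ respecting $f$, i.e. $X_i$ precedes $X_j$ whenever $f(X_i)<f(X_j)$. Let $SV_1$ be a prefix of $SV$. Then the number of distinct functions $F_S$, where $S$ ranges over truth assignments to the variables of $SV_1$, is at most $1+2\cdot 2^p$.
   Context: The incidence graph of a CNF has a vertex for each variable and a vertex for each clause, a variable vertex being adjacent to a clause vertex iff the variable occurs in the clause. A path decomposition of a graph $G$ is a path $P$ together with bags $B(v)\subseteq V(G)$ for $v\in V(P)$ such that every vertex of $G$ is in some bag, every edge of $G$ has both ends in some bag, and for each vertex of $G$ the set of path vertices whose bags contain it is a subpath; its width is the maximum bag size minus one. For a truth assignment $S$ to a set of variables, $F_S$ is the function on the remaining variables whose satisfying assignments are those $S'$ with $S\cup S'$ satisfying $F$. -}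

module Defs where

open import Data.Nat using (ℕ; _<_; _≤_; _+_; _*_; _^_; suc)
open import Data.Fin using (Fin; toℕ)
open import Data.Bool using (Bool; if_then_else_)
open import Data.Nat using (_<ᵇ_)
open import Data.Product using (_×_; ∃; ∃-syntax; proj₁; proj₂)
open import Data.Sum using (_⊎_; inj₁; inj₂)
open import Data.List using (List; length)
open import Data.List.Membership.Propositional using (_∈_)
open import Data.List.Relation.Unary.Any using (Any)
open import Data.List.Relation.Unary.All using (All)
open import Data.List.Relation.Unary.Unique.Propositional using (Unique)
open import Data.Fin.Permutation using (Permutation′; _⟨$⟩ˡ_)
open import Relation.Binary.PropositionalEquality using (_≡_)
open import Relation.Nullary using (¬_)
open import Function using (_⇔_)

-- A literal over variables Fin n: (variable , polarity); polarity true = positive.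
Literal : ℕ → Set
Literal n = Fin n × Bool

Clause : ℕ → Set
Clause n = List (Literal n)

CNF : ℕ → ℕ → Set
CNF n m = Fin m → Clause n

Assignment : ℕ → Set
Assignment n = Fin n → Bool

LitTrue : ∀ {n} → Assignment n → Literal n → Set
LitTrue α l = α (proj₁ l) ≡ proj₂ l

ClauseSat : ∀ {n} → Assignment n → Clause n → Set
ClauseSat α C = Any (LitTrue α) C

Sat : ∀ {n m} → CNF n m → Assignment n → Set
Sat F α = ∀ j → ClauseSat α (F j)

Occurs : ∀ {n} → Fin n → Clause n → Set
Occurs x C = Any (λ l → proj₁ l ≡ x) C

-- Incidence graph: vertices are variables (inj₁) and clauses (inj₂).
Vertex : ℕ → ℕ → Set
Vertex n m = Fin n ⊎ Fin m

IncEdge : ∀ {n m} → CNF n m → Fin n → Fin m → Set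
IncEdge F x j = Occurs x (F j)

-- Bags of a path decomposition along the path v_1..v_r (indexed by Fin r
-- in path order); each bag is a duplicate-free list (a finite set).
Bags : ℕ → ℕ → ℕ → Set
Bags n m r = Fin r → List (Vertex n m)

record IsPathDecomposition {n m r : ℕ} (F : CNF n m) (B : Bags n m r) : Set where
  field
    bagsUnique : ∀ k → Unique (B k)
    vertexCovered : ∀ (v : Vertex n m) → ∃[ k ] (v ∈ B k)
    edgeCovered : ∀ x j → IncEdge F x j → ∃[ k ] (inj₁ x ∈ B k × inj₂ j ∈ B k)
    subpath : ∀ (v : Vertex n m) (i j k : Fin r) →
      toℕ i ≤ toℕ j → toℕ j ≤ toℕ k → v ∈ B i → v ∈ B k → v ∈ B j

-- width = max bag size − 1, i.e. all bags have size ≤ p+1 and some has size p+1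
record HasWidth {n m r : ℕ} (B : Bags n m r) (p : ℕ) : Set where
  field
    bagsSmall : ∀ k → length (B k) ≤ suc p
    bagAttains : ∃[ k ] (length (B k) ≡ suc p)

IsFirstBag : ∀ {n m r} → Bags n m r → Fin n → Fin r → Set
IsFirstBag B x j = (inj₁ x ∈ B j) × (∀ k → toℕ k < toℕ j → ¬ (inj₁ x ∈ B k))

-- SV given as a permutation σ: σ ⟨$⟩ʳ k is the k-th variable in SV,
-- so the position of variable x in SV is σ ⟨$⟩ˡ x.
position : ∀ {n} → Permutation′ n → Fin n → Fin n
position σ x = σ ⟨$⟩ˡ x

RespectsF : ∀ {n m r} → Bags n m r → Permutation′ n → Set
RespectsF {n} B σ = ∀ (x y : Fin n) jx jy → IsFirstBag B x jx → IsFirstBag B y jy →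
  toℕ jx < toℕ jy → toℕ (position σ x) < toℕ (position σ y)

-- Combine an assignment S to the prefix SV_1 (the first t variables of SV)
-- with an assignment T to the remaining variables.  Assignments are total
-- functions; only the values of S on SV_1 and of T outside SV_1 are used.
merge : ∀ {n} → Permutation′ n → ℕ → Assignment n → Assignment n → Assignment n
merge σ t S T x = if toℕ (position σ x) <ᵇ t then S x else T x

-- F_S = F_{S'} : both residual functions have the same satisfying assignments
SameResidual : ∀ {n m} → CNF n m → Permutation′ n → ℕ → Assignment n → Assignment n → Set
SameResidual {n} F σ t S S' = ∀ (T : Assignment n) → Sat F (merge σ t S T) ⇔ Sat F (merge σ t S' T)

-- the number of distinct F_S (S ranging over assignments to SV_1) is ≤ K:
-- there are at most K assignments whose residuals cover all residuals.
NumResidualsAtMost : ∀ {n m} → CNF n m → Permutation′ n → ℕ → ℕ → Set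
NumResidualsAtMost {n} F σ t K = ∃[ L ] (length L ≤ K ×
  (∀ (S : Assignment n) → Any (λ S' → SameResidual F σ t S S') L))

module Submission where

-- Let the prefix SV_1 consist of the first t variables of SV.  Otherwise let x0 be the last prefix variable and j = f(x0).
-- Because SV respects f, prefix variables first occur in a bag at or before j
-- and all other variables at or after j; together with the subpath property
-- this shows that the bag B(v_j) SEPARATES the prefix: a clause with both a
-- prefix and a non-prefix variable either lies in B(v_j), or each of its
-- prefix variables does.  For any separating vertex set K, F_S is determined by
-- a code of S: "nothing" if S already falsifies a clause whose variables all
-- lie in the prefix, and otherwise the vector recording, for each vertex of K,
-- the value of S on it (variables) or whether S satisfies it (clauses).  There
-- are at most 1 + 2^|K| codes, and |B(v_j)| <= p + 1 gives the bound 1 + 2*2^p.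

open import Defs
open import Data.Nat using (ℕ; zero; suc; _≤_; _<_; _+_; _*_; _^_; _<ᵇ_; s≤s; z≤n)
open import Data.Nat.Properties
  using (_<?_; _≤?_; ≤-trans; ≤-reflexive; ≤-pred; <⇒≤; <⇒≱; ≮⇒≥; ≰⇒>; +-identityʳ;
         +-monoʳ-≤; ^-monoʳ-≤; <ᵇ-reflects-<)
open import Data.Fin using (Fin; toℕ; fromℕ<; zero; suc)
open import Data.Fin.Properties using (all?; toℕ-fromℕ<)
open import Data.Fin.Subset.Properties using (anySubset?)
open import Data.Fin.Permutation using (Permutation′; _⟨$⟩ʳ_; inverseˡ)
open import Data.Bool using (Bool; true; false)
import Data.Bool as Bool
open import Data.Maybe using (Maybe; just; nothing)
open import Data.List using (List; []; _∷_; map; length; _++_)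
import Data.List as List
open import Data.List.Properties using (length-map; length-++)
open import Data.List.Relation.Unary.Any using (Any; here; there; any?; index)
import Data.List.Relation.Unary.Any as Any
open import Data.List.Relation.Unary.Any.Properties using (Any-⊎⁻; lookup-index)
open import Data.List.Membership.Propositional using (_∈_; find; lose)
open import Data.List.Membership.Propositional.Properties using (∈-map⁺; ∈-++⁺ˡ; ∈-++⁺ʳ)
open import Data.Vec using (Vec; tabulate; lookup)
import Data.Vec as Vec
open import Data.Vec.Properties using (lookup∘tabulate)
open import Data.Product using (_×_; ∃; ∃-syntax; proj₁; proj₂; _,_)
open import Data.Sum using (_⊎_; inj₁; inj₂)
import Data.Sum.Properties as Sum
import Data.Maybe.Properties
open import Relation.Nullary using (¬_; Dec; yes; no; does; contradiction; ¬?; _×-dec_; _⊎-dec_)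
open import Relation.Nullary.Reflects using (ofʸ; ofⁿ)
open import Relation.Unary using (Decidable)
open import Relation.Binary.Definitions using (DecidableEquality)
open import Relation.Binary.PropositionalEquality using (_≡_; refl; sym; trans; cong; cong₂; module ≡-Reasoning)
open import Function using (_∘_)
open import Function.Bundles using (mk⇔; Equivalence)

-- Two decisions with the same Boolean outcome transport evidence; this is how
-- equal code bits for a clause give equal satisfaction facts.
does-transport : ∀ {A B : Set} (a? : Dec A) (b? : Dec B) → does a? ≡ does b? → A → B
does-transport (yes _) (yes b) _  _ = b
does-transport (yes _) (no _)  () _
does-transport (no ¬a) _       _  a = contradiction a ¬a

tag : ∀ {A V : Set} → Dec A → V → Maybe V
tag (yes _) v = just v
tag (no _)  _ = nothing

tag-injective : ∀ {A B V : Set} (a? : Dec A) (b? : Dec B) {v w : V} →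
  A → tag a? v ≡ tag b? w → B × v ≡ w
tag-injective (yes _) (yes b) _ refl = b , refl
tag-injective (yes _) (no _)  _ ()
tag-injective (no ¬a) _       a _    = contradiction a ¬a

tag-∈ : ∀ {A V : Set} (a? : Dec A) {v : V} {vs} → v ∈ vs → tag a? v ∈ nothing ∷ map just vs
tag-∈ (yes _) v∈ = there (∈-map⁺ just v∈)
tag-∈ (no _)  _  = here refl

tabulate-agree : ∀ {A B : Set} (K : List A) (f g : A → B) →
  tabulate (f ∘ List.lookup K) ≡ tabulate (g ∘ List.lookup K) → ∀ v → v ∈ K → f v ≡ g v
tabulate-agree K f g eq v v∈ = begin
  f v                                        ≡⟨ cong f (lookup-index v∈) ⟩
  f (List.lookup K i)                        ≡⟨ sym (lookup∘tabulate (f ∘ List.lookup K) i) ⟩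
  lookup (tabulate (f ∘ List.lookup K)) i    ≡⟨ cong (λ u → lookup u i) eq ⟩
  lookup (tabulate (g ∘ List.lookup K)) i    ≡⟨ lookup∘tabulate (g ∘ List.lookup K) i ⟩
  g (List.lookup K i)                        ≡⟨ cong g (sym (lookup-index v∈)) ⟩
  g v                                        ∎
  where
  open ≡-Reasoning
  i : Fin (length K)
  i = index v∈

allBoolVecs : ∀ k → List (Vec Bool k)
allBoolVecs zero    = Vec.[] ∷ []
allBoolVecs (suc k) = map (false Vec.∷_) (allBoolVecs k) ++ map (true Vec.∷_) (allBoolVecs k)

allBoolVecs-length : ∀ k → length (allBoolVecs k) ≡ 2 ^ k
allBoolVecs-length zero    = refl
allBoolVecs-length (suc k) = begin
  length (map (false Vec.∷_) vs ++ map (true Vec.∷_) vs)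
    ≡⟨ length-++ (map (false Vec.∷_) vs) ⟩
  length (map (false Vec.∷_) vs) + length (map (true Vec.∷_) vs)
    ≡⟨ cong₂ _+_ (length-map (false Vec.∷_) vs) (length-map (true Vec.∷_) vs) ⟩
  length vs + length vs
    ≡⟨ cong₂ _+_ (allBoolVecs-length k) (trans (allBoolVecs-length k) (sym (+-identityʳ (2 ^ k)))) ⟩
  2 ^ suc k ∎
  where
  open ≡-Reasoning
  vs : List (Vec Bool k)
  vs = allBoolVecs k

allBoolVecs-complete : ∀ {k} (v : Vec Bool k) → v ∈ allBoolVecs k
allBoolVecs-complete Vec.[]            = here refl
allBoolVecs-complete (false Vec.∷ v) = ∈-++⁺ˡ (∈-map⁺ (false Vec.∷_) (allBoolVecs-complete v))
allBoolVecs-complete (true Vec.∷ v)  =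
  ∈-++⁺ʳ (map (false Vec.∷_) _) (∈-map⁺ (true Vec.∷_) (allBoolVecs-complete v))

leastIndex : ∀ {r} {P : Fin r → Set} → Decidable P → ∃ P →
  ∃[ j ] (P j × (∀ k → toℕ k < toℕ j → ¬ P k))
leastIndex P? (zero , p0) = zero , p0 , λ _ ()
leastIndex P? (suc i , pi) with P? zero
... | yes p0 = zero , p0 , λ _ ()
... | no ¬p0 with leastIndex (P? ∘ suc) (i , pi)
...   | j , pj , below = suc j , pj , λ { zero _ → ¬p0 ; (suc k) (s≤s k<j) → below k k<j }

module Residuals {n m : ℕ} (F : CNF n m) (σ : Permutation′ n) (t : ℕ) where

  InPrefix : Fin n → Set
  InPrefix x = toℕ (position σ x) < t

  inPrefix? : Decidable InPrefix
  inPrefix? x = toℕ (position σ x) <? t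

  merge-inside : ∀ S T {x} → InPrefix x → merge σ t S T x ≡ S x
  merge-inside S T {x} p with toℕ (position σ x) <ᵇ t | <ᵇ-reflects-< (toℕ (position σ x)) t
  ... | true  | _      = refl
  ... | false | ofⁿ ¬p = contradiction p ¬p

  merge-outside : ∀ S T {x} → ¬ InPrefix x → merge σ t S T x ≡ T x
  merge-outside S T {x} ¬p with toℕ (position σ x) <ᵇ t | <ᵇ-reflects-< (toℕ (position σ x)) t
  ... | true  | ofʸ p = contradiction p ¬p
  ... | false | _     = refl

  residual-local : ∀ {S S'} → (∀ x → InPrefix x → S x ≡ S' x) → SameResidual F σ t S S'
  residual-local {S} {S'} agree T = mk⇔ (transport agree) (transport (λ x p → sym (agree x p)))
    where
    transport : ∀ {U U'} → (∀ x → InPrefix x → U x ≡ U' x) → Sat F (merge σ t U T) → Sat F (merge σ t U' T)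
    transport {U} {U'} agr sat c = Any.map (λ {l} lt → trans (sym (same (proj₁ l))) lt) (sat c)
      where
      same : ∀ x → merge σ t U T x ≡ merge σ t U' T x
      same x with inPrefix? x
      ... | yes p = trans (merge-inside U T p) (trans (agr x p) (sym (merge-inside U' T p)))
      ... | no ¬p = trans (merge-outside U T ¬p) (sym (merge-outside U' T ¬p))

  residual-trans : ∀ {S S' S''} → SameResidual F σ t S S' → SameResidual F σ t S' S'' →
    SameResidual F σ t S S''
  residual-trans a b T = mk⇔ (Equivalence.to (b T) ∘ Equivalence.to (a T))
                             (Equivalence.from (a T) ∘ Equivalence.from (b T))

  numResiduals-mono : ∀ {K K'} → K ≤ K' → NumResidualsAtMost F σ t K → NumResidualsAtMost F σ t K'
  numResiduals-mono K≤K' (L , len≤K , cover) = L , ≤-trans len≤K K≤K' , cover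

  -- A representative for each code is found
  -- by searching all Boolean vectors, read as assignments.
  residualsBoundedByCodes : ∀ {C : Set} → DecidableEquality C → (code : Assignment n → C) (cs : List C) →
    (∀ S → code S ∈ cs) → (∀ S S' → code S ≡ code S' → SameResidual F σ t S S') →
    NumResidualsAtMost F σ t (length cs)
  residualsBoundedByCodes {C} _≟_ code cs codes sound =
    map representative cs , ≤-reflexive (length-map representative cs) , cover
    where
    representative : C → Assignment n
    representative c with anySubset? (λ v → code (lookup v) ≟ c)
    ... | yes (v , _) = lookup v
    ... | no _        = λ _ → false

    representative-code : ∀ v → code (representative (code (lookup v))) ≡ code (lookup v)
    representative-code v with anySubset? (λ u → code (lookup u) ≟ code (lookup v))
    ... | yes (_ , e) = e
    ... | no none     = contradiction (v , refl) none

    cover : ∀ S → Any (SameResidual F σ t S) (map representative cs)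
    cover S = lose (∈-map⁺ representative (codes S₀))
      (residual-trans (residual-local (λ x _ → sym (lookup∘tabulate S x)))
                      (sound S₀ _ (sym (representative-code (tabulate S)))))
      where
      S₀ : Assignment n
      S₀ = lookup (tabulate S)

  PrefixSat : Assignment n → Clause n → Set
  PrefixSat S C = Any (λ l → InPrefix (proj₁ l) × LitTrue S l) C

  prefixSat? : ∀ S → Decidable (PrefixSat S)
  prefixSat? S = any? (λ l → inPrefix? (proj₁ l) ×-dec (S (proj₁ l) Bool.≟ proj₂ l))

  Open : Clause n → Set
  Open C = Any (λ l → ¬ InPrefix (proj₁ l)) C

  Consistent : Assignment n → Set
  Consistent S = ∀ c → PrefixSat S (F c) ⊎ Open (F c)

  consistent? : Decidable Consistent
  consistent? S = all? (λ c → prefixSat? S (F c) ⊎-dec any? (λ l → ¬? (inPrefix? (proj₁ l))) (F c))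

  prefixSat⇒sat : ∀ S T {C} → PrefixSat S C → ClauseSat (merge σ t S T) C
  prefixSat⇒sat S T = Any.map (λ (p , lt) → trans (merge-inside S T p) lt)

  sat⇒consistent : ∀ {S T} → Sat F (merge σ t S T) → Consistent S
  sat⇒consistent {S} {T} sat c = Any-⊎⁻ (Any.map split (sat c))
    where
    split : ∀ {l} → LitTrue (merge σ t S T) l → (InPrefix (proj₁ l) × LitTrue S l) ⊎ ¬ InPrefix (proj₁ l)
    split {l} lt with inPrefix? (proj₁ l)
    ... | yes p = inj₁ (p , trans (sym (merge-inside S T p)) lt)
    ... | no ¬p = inj₂ ¬p

  Separating : List (Vertex n m) → Set
  Separating K = ∀ c y z → Occurs y (F c) → Occurs z (F c) → InPrefix y → ¬ InPrefix z →
    inj₂ c ∈ K ⊎ inj₁ y ∈ K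

  occurs-∈ : ∀ {l : Literal n} {C} → l ∈ C → Occurs (proj₁ l) C
  occurs-∈ = Any.map (λ e → cong proj₁ (sym e))

  module Code (K : List (Vertex n m)) (separating : Separating K) where

    bit : Assignment n → Vertex n m → Bool
    bit S (inj₁ y) = S y
    bit S (inj₂ c) = does (prefixSat? S (F c))

    residualCode : Assignment n → Maybe (Vec Bool (length K))
    residualCode S = tag (consistent? S) (tabulate (bit S ∘ List.lookup K))

    -- Either S' satisfies c on the prefix already,
    -- or c is open, and then the separator contains c or x, where S' agrees with S.
    transfer-prefix : ∀ {S S' T x b} c → Consistent S' → (∀ v → v ∈ K → bit S v ≡ bit S' v) →
      (x , b) ∈ F c → InPrefix x → S x ≡ b → ClauseSat (merge σ t S' T) (F c)
    transfer-prefix {S} {S'} {T} {x} c consistent' agree l∈ p Sx≡b with consistent' c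
    ... | inj₁ prefixSat' = prefixSat⇒sat S' T prefixSat'
    ... | inj₂ open′ with find open′
    ...   | (z , _) , z∈ , ¬pz with separating c x z (occurs-∈ l∈) (occurs-∈ z∈) p ¬pz
    ...     | inj₁ c∈K = prefixSat⇒sat S' T
                (does-transport (prefixSat? S (F c)) (prefixSat? S' (F c)) (agree _ c∈K) (lose l∈ (p , Sx≡b)))
    ...     | inj₂ x∈K = lose l∈ (trans (merge-inside S' T p) (trans (sym (agree _ x∈K)) Sx≡b))

    transfer : ∀ {S S' T} c → Consistent S' → (∀ v → v ∈ K → bit S v ≡ bit S' v) →
      ClauseSat (merge σ t S T) (F c) → ClauseSat (merge σ t S' T) (F c)
    transfer {S} {S'} {T} c consistent' agree sat with find sat
    ... | (x , b) , l∈ , lt with inPrefix? x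
    ...   | yes p = transfer-prefix c consistent' agree l∈ p (trans (sym (merge-inside S T p)) lt)
    ...   | no ¬p = lose l∈ (trans (merge-outside S' T ¬p) (trans (sym (merge-outside S T ¬p)) lt))

    residual-of-code : ∀ S S' → residualCode S ≡ residualCode S' → SameResidual F σ t S S'
    residual-of-code S S' eq T = mk⇔ (direction S S' eq) (direction S' S (sym eq))
      where
      direction : ∀ S S' → residualCode S ≡ residualCode S' → Sat F (merge σ t S T) → Sat F (merge σ t S' T)
      direction S S' eq sat c with tag-injective (consistent? S) (consistent? S') (sat⇒consistent sat) eq
      ... | consistent' , bits≡ =
        transfer c consistent' (tabulate-agree K (bit S) (bit S') bits≡) (sat c)

    residualsBySeparator : NumResidualsAtMost F σ t (1 + 2 ^ length K)
    residualsBySeparator = numResiduals-mono (≤-reflexive (cong suc lengthCodes))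
      (residualsBoundedByCodes codeEquality? residualCode codes
        (λ S → tag-∈ (consistent? S) (allBoolVecs-complete (tabulate (bit S ∘ List.lookup K)))) residual-of-code)
      where
      codeEquality? : DecidableEquality (Maybe (Vec Bool (length K)))
      codeEquality? = Data.Maybe.Properties.≡-dec (Data.Vec.Properties.≡-dec Bool._≟_)
      codes : List (Maybe (Vec Bool (length K)))
      codes = nothing ∷ map just (allBoolVecs (length K))
      lengthCodes : length (map just (allBoolVecs (length K))) ≡ 2 ^ length K
      lengthCodes = trans (length-map just (allBoolVecs (length K))) (allBoolVecs-length (length K))

module FirstBags {n m r : ℕ} {F : CNF n m} {B : Bags n m r} (pd : IsPathDecomposition F B) where
  open IsPathDecomposition pd
  open import Data.List.Membership.DecPropositional (Sum.≡-dec (Data.Fin._≟_ {n}) (Data.Fin._≟_ {m}))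
    using (_∈?_)

  firstBag : ∀ x → ∃[ f ] IsFirstBag B x f
  firstBag x = leastIndex (λ k → inj₁ x ∈? B k) (vertexCovered (inj₁ x))

  firstBag-least : ∀ {x f k} → IsFirstBag B x f → inj₁ x ∈ B k → toℕ f ≤ toℕ k
  firstBag-least (_ , below) x∈ = ≮⇒≥ (λ k<f → below _ k<f x∈)

  firstBag-monotone : ∀ σ → RespectsF B σ → ∀ {x y fx fy} → IsFirstBag B x fx → IsFirstBag B y fy →
    toℕ (position σ x) ≤ toℕ (position σ y) → toℕ fx ≤ toℕ fy
  firstBag-monotone σ respects fx fy pos≤ = ≮⇒≥ (λ fy<fx → <⇒≱ (respects _ _ _ _ fy fx fy<fx) pos≤)

  firstBag-separates : ∀ σ t → RespectsF B σ → ∀ x0 →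
    (∀ y → Residuals.InPrefix F σ t y → toℕ (position σ y) ≤ toℕ (position σ x0)) →
    (∀ z → ¬ Residuals.InPrefix F σ t z → toℕ (position σ x0) ≤ toℕ (position σ z)) →
    Residuals.Separating F σ t (B (proj₁ (firstBag x0)))
  firstBag-separates σ t respects x0 beforeX0 afterX0 c y z y∈c z∈c py ¬pz
    with firstBag x0 | firstBag y | firstBag z | edgeCovered y c y∈c | edgeCovered z c z∈c
  ... | j , first0 | fy , firstY | fz , firstZ | k₁ , y∈k₁ , c∈k₁ | k₂ , z∈k₂ , c∈k₂ with toℕ k₁ ≤? toℕ j
  ... | yes k₁≤j = inj₁ (subpath (inj₂ c) k₁ j k₂ k₁≤j j≤k₂ c∈k₁ c∈k₂)
    where
    j≤k₂ : toℕ j ≤ toℕ k₂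
    j≤k₂ = ≤-trans (firstBag-monotone σ respects first0 firstZ (afterX0 z ¬pz)) (firstBag-least firstZ z∈k₂)
  ... | no k₁≰j = inj₂ (subpath (inj₁ y) fy j k₁ fy≤j (<⇒≤ (≰⇒> k₁≰j)) (proj₁ firstY) y∈k₁)
    where
    fy≤j : toℕ fy ≤ toℕ j
    fy≤j = firstBag-monotone σ respects firstY first0 (beforeX0 y py)

lemma5 : ∀ {n m r : ℕ} (F : CNF n m) (B : Bags n m r) (p : ℕ) →
    IsPathDecomposition F B → HasWidth B p →
    (σ : Permutation′ n) → RespectsF B σ →
    (t : ℕ) → t ≤ n →
    NumResidualsAtMost F σ t (1 + 2 * 2 ^ p)
lemma5 F B p pd width σ respects zero _ =
  (λ _ → false) ∷ [] , s≤s z≤n , λ S → here (residual-local {S} {λ _ → false} (λ _ ()))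
  where open Residuals F σ zero
lemma5 {n} {r = r} F B p pd width σ respects (suc t') t≤n =
  numResiduals-mono (+-monoʳ-≤ 1 (^-monoʳ-≤ 2 (HasWidth.bagsSmall width j)))
    (Code.residualsBySeparator (B j)
      (firstBag-separates σ (suc t') respects x0 prefix-before rest-after))
  where
  open Residuals F σ (suc t')
  open FirstBags pd
  x0 : Fin n
  x0 = σ ⟨$⟩ʳ fromℕ< t≤n
  j : Fin r
  j = proj₁ (firstBag x0)
  posX0 : toℕ (position σ x0) ≡ t'
  posX0 = trans (cong toℕ (inverseˡ σ)) (toℕ-fromℕ< t≤n)
  prefix-before : ∀ y → InPrefix y → toℕ (position σ y) ≤ toℕ (position σ x0)
  prefix-before y py rewrite posX0 = ≤-pred py
  rest-after : ∀ z → ¬ InPrefix z → toℕ (position σ x0) ≤ toℕ (position σ z)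
  rest-after z ¬pz rewrite posX0 = <⇒≤ (≮⇒≥ ¬pz)
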